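{- Let $s\ge1$ be an integer and $n$ a positive integer with $n>f_{s-1}f_{s-2}$. Then $s(n)\ge s$.
   Context: $f_k$ are the Fibonacci numbers, $f_1=f_2=1$, $f_{k+2}=f_{k+1}+f_k$, with $f_0=0$, $f_{ -1}=1$. For positive integers $a_1,a_2$, $w_k=w_k(a_1,a_2)$ is the sequence with $w_1=a_1$, $w_2=a_2$, $w_{k+2}=w_{k+1}+w_k$. Let $s(n;a_1,a_2)$ be the integer $s$ with $w_s(a_1,a_2)=n$ ($-\infty$ if none), and $s(n)=\max_{a_1,a_2\ge1}s(n;a_1,a_2)$. -}

module Defs where

open import Data.Nat using (ℕ; zero; suc; _+_; _*_; _≤_)
open import Data.Product using (Σ; _×_)
open import Relation.Binary.PropositionalEquality using (_≡_)

fib : ℕ → ℕ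
fib zero = zero
fib (suc zero) = suc zero
fib (suc (suc k)) = fib (suc k) + fib k

-- fibPred k = f_{k-1}, using the convention f_{-1} = 1
fibPred : ℕ → ℕ
fibPred zero = suc zero
fibPred (suc k) = fib k

-- w a b k = w_k(a,b) for k ≥ 1: w_1 = a, w_2 = b, w_{k+2} = w_{k+1} + w_k.
-- (index 0 is not part of the sequence; its value 0 is never used)
w : ℕ → ℕ → ℕ → ℕ
w a b zero = zero
w a b (suc zero) = a
w a b (suc (suc zero)) = b
w a b (suc (suc (suc k))) = w a b (suc (suc k)) + w a b (suc k)

-- "s(n) ≥ s": some admissible (a1,a2) and some index t ≥ s with w_t(a1,a2) = n
-- (the maximum s(n) is ≥ s iff some s(n;a1,a2) ≥ s).
sAtLeast : ℕ → ℕ → Set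
sAtLeast n s = Σ ℕ λ a₁ → Σ ℕ λ a₂ → Σ ℕ λ t →
  1 ≤ a₁ × 1 ≤ a₂ × s ≤ t × w a₁ a₂ t ≡ n

-- Here w_{k+2}(a, b) = f_k a + f_{k+1} b, so it suffices to write n = f_k a + f_{k+1} b with
-- a, b ≥ 1. Consecutive Fibonacci numbers are coprime, and for coprime p, q every n > p q is
-- a positive combination p a + q b: take a ∈ [1, q] with p a ≡ n (mod q); then n - p a > 0 is
-- a multiple of q.
module Submission where

open import Data.Nat using (ℕ; zero; suc; _+_; _*_; _∸_; _≤_; _<_; z≤n; s≤s; NonZero; >-nonZero)
open import Data.Nat.Properties
open import Data.Nat.DivMod using (_%_; _/_; m%n<n; m≡m%n+[m/n]*n)
open import Data.Nat.Coprimality using (Coprime; coprime-+; 1-coprimeTo; coprime-Bézout)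
  renaming (sym to coprime-sym)
open import Data.Nat.GCD using (module Bézout)
open import Data.Nat.Tactic.RingSolver using (solve-∀)
open import Algebra.Properties.CommutativeSemigroup *-commutativeSemigroup using (x∙yz≈y∙xz; x∙yz≈z∙yx)
open import Data.Product using (∃; ∃₂; _×_; _,_)
open import Data.Empty using (⊥-elim)
open import Relation.Nullary using (yes; no)
open import Relation.Binary.PropositionalEquality
open import Defs

fib-suc-positive : ∀ k → 1 ≤ fib (suc k)
fib-suc-positive zero    = s≤s z≤n
fib-suc-positive (suc k) = ≤-trans (fib-suc-positive k) (m≤m+n _ _)

fib-coprime : ∀ k → Coprime (fib k) (fib (suc k))
fib-coprime zero    = coprime-sym (1-coprimeTo 0)
fib-coprime (suc k) = coprime-sym (coprime-+ (fib-coprime k))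

w-fib : ∀ a b k → w a b (suc (suc k)) ≡ fib k * a + fib (suc k) * b
w-fib a b zero          = sym (+-identityʳ b)
w-fib a b (suc zero)    = trans (+-comm b a) (sym (cong₂ _+_ (+-identityʳ a) (+-identityʳ b)))
w-fib a b (suc (suc k)) = begin
  w a b (suc (suc (suc k))) + w a b (suc (suc k))
    ≡⟨ cong₂ _+_ (w-fib a b (suc k)) (w-fib a b k) ⟩
  fib (suc k) * a + fib (suc (suc k)) * b + (fib k * a + fib (suc k) * b)
    ≡⟨ regroup (fib k) (fib (suc k)) (fib (suc (suc k))) a b ⟩
  fib (suc (suc k)) * a + fib (suc (suc (suc k))) * b
    ∎
  where
  open ≡-Reasoning
  regroup : ∀ f₀ f₁ f₂ a b → f₁ * a + f₂ * b + (f₀ * a + f₁ * b) ≡ (f₁ + f₀) * a + (f₂ + f₁) * b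
  regroup = solve-∀

-- n + q M ≡ m + q N is the subtraction-free form of n ≡ m (mod q).
congruent-above⇒positive-multiple : ∀ {m n q M N} → m < n → n + q * M ≡ m + q * N →
                                    ∃ λ b → 1 ≤ b × n ≡ m + q * b
congruent-above⇒positive-multiple {m} {n} {q} {M} {N} m<n eq with M ≤? N
... | no M≰N = ⊥-elim (<-irrefl (sym eq) (+-mono-<-≤ m<n (*-monoʳ-≤ q (<⇒≤ (≰⇒> M≰N)))))
... | yes M≤N with b , refl ← m≤n⇒∃[o]m+o≡n M≤N = b , positive b n≡m+qb , n≡m+qb
  where
  n≡m+qb : n ≡ m + q * b
  n≡m+qb = +-cancelʳ-≡ (q * M) n (m + q * b) (trans eq (shift m q M b))
    where
    shift : ∀ m q M b → m + q * (M + b) ≡ m + q * b + q * M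
    shift = solve-∀
  positive : ∀ b → n ≡ m + q * b → 1 ≤ b
  positive (suc _) _ = s≤s z≤n
  positive zero n≡m+q*0 = ⊥-elim (<-irrefl (sym n≡m) m<n)
    where
    n≡m : n ≡ m
    n≡m = trans n≡m+q*0 (trans (cong (m +_) (*-zeroʳ q)) (+-identityʳ m))

negated-residue : ∀ m q .{{_ : NonZero q}} → ∃ λ a → 1 ≤ a × a ≤ q × ∃ λ c → a + m ≡ q * c
negated-residue m q = q ∸ r , m<n⇒0<n∸m (m%n<n m q) , m∸n≤m q r , suc d , a+m≡q[1+d]
  where
  r = m % q
  d = m / q
  a+m≡q[1+d] : q ∸ r + m ≡ q * suc d
  a+m≡q[1+d] = begin
    q ∸ r + m           ≡⟨ cong (q ∸ r +_) (m≡m%n+[m/n]*n m q) ⟩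
    q ∸ r + (r + d * q) ≡⟨ +-assoc (q ∸ r) r (d * q) ⟨
    q ∸ r + r + d * q   ≡⟨ cong (_+ d * q) (m∸n+n≡m (<⇒≤ (m%n<n m q))) ⟩
    q + d * q           ≡⟨ cong (q +_) (*-comm d q) ⟩
    q + q * d           ≡⟨ *-suc q d ⟨
    q * suc d           ∎
    where open ≡-Reasoning

-- From x p ≡ 1 (mod q) we get q′ x p ≡ q′ ≡ -1 (mod q), where q = q′ + 1.
negated-inverse : ∀ {p q} .{{_ : NonZero q}} → Bézout.Identity 1 p q →
                  ∃₂ λ x y → 1 + x * p ≡ y * q
negated-inverse (Bézout.-+ x y 1+xp≡yq) = x , y , 1+xp≡yq
negated-inverse {p} {suc q′} (Bézout.+- x y 1+yq≡xp) = q′ * x , suc (q′ * y) , (begin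
  1 + q′ * x * p             ≡⟨ cong suc (*-assoc q′ x p) ⟩
  1 + q′ * (x * p)           ≡⟨ cong (λ t → 1 + q′ * t) 1+yq≡xp ⟨
  1 + q′ * (1 + y * suc q′)  ≡⟨ factor q′ y ⟩
  suc (q′ * y) * suc q′      ∎)
  where
  open ≡-Reasoning
  factor : ∀ q′ y → 1 + q′ * (1 + y * suc q′) ≡ suc (q′ * y) * suc q′
  factor = solve-∀

-- If x p ≡ -1 and a ≡ -n x (mod q), then p a ≡ n (mod q).
scaled-residue-congruent : ∀ {p q n x y a c} → 1 + x * p ≡ y * q → a + n * x ≡ q * c →
                           n + q * (p * c) ≡ p * a + q * (y * n)
scaled-residue-congruent {p} {q} {n} {x} {y} {a} {c} 1+xp≡yq a+nx≡qc = begin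
  n + q * (p * c)         ≡⟨ cong (n +_) (x∙yz≈y∙xz q p c) ⟩
  n + p * (q * c)         ≡⟨ cong (λ t → n + p * t) a+nx≡qc ⟨
  n + p * (a + n * x)     ≡⟨ expand n p a x ⟩
  p * a + n * (1 + x * p) ≡⟨ cong (λ t → p * a + n * t) 1+xp≡yq ⟩
  p * a + n * (y * q)     ≡⟨ cong (p * a +_) (x∙yz≈z∙yx n y q) ⟩
  p * a + q * (y * n)     ∎
  where
  open ≡-Reasoning
  expand : ∀ n p a x → n + p * (a + n * x) ≡ p * a + n * (1 + x * p)
  expand = solve-∀

coprime⇒positive-combination : ∀ {p q n} .{{_ : NonZero q}} → Coprime p q → p * q < n →
                               ∃₂ λ a b → 1 ≤ a × 1 ≤ b × n ≡ p * a + q * b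
coprime⇒positive-combination {p} {q} {n} coprime pq<n
  with x , y , 1+xp≡yq ← negated-inverse (coprime-Bézout coprime)
  with a , 1≤a , a≤q , c , a+nx≡qc ← negated-residue (n * x) q
  with b , 1≤b , n≡pa+qb ← congruent-above⇒positive-multiple {q = q}
         (≤-<-trans (*-monoʳ-≤ p a≤q) pq<n)
         (scaled-residue-congruent {p} {q} {n} {x} {y} 1+xp≡yq a+nx≡qc)
  = a , b , 1≤a , 1≤b , n≡pa+qb

lemma10 : (k n : ℕ) → 1 ≤ n → fib k * fibPred k < n → sAtLeast n (suc k)
lemma10 zero    n 1≤n _ = n , 1 , 1 , 1≤n , ≤-refl , ≤-refl , refl
lemma10 (suc k) n _ fₖ₊₁fₖ<n =
  let fₖfₖ₊₁<n = subst (_< n) (*-comm (fib (suc k)) (fib k)) fₖ₊₁fₖ<n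
      a , b , 1≤a , 1≤b , n≡fₖa+fₖ₊₁b = coprime⇒positive-combination
        {{>-nonZero (fib-suc-positive k)}} (fib-coprime k) fₖfₖ₊₁<n
  in  a , b , suc (suc k) , 1≤a , 1≤b , ≤-refl , trans (w-fib a b k) (sym n≡fₖa+fₖ₊₁b)
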